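{- If a Dyck path $P$ has $k$ non-initial contacts, then $\operatorname{mir}(P)$ ends with $k$ consecutive down steps.
   Context: A Dyck path is a (possibly empty) word in $u$ (up step) and $d$ (down step) with equally many $u$ and $d$ and every prefix having at least as many $u$ as $d$; viewed as a lattice path from the origin, its contacts are its lattice points on the $x$-axis, and the non-initial contacts are those other than the origin. Every nonempty Dyck path $D$ can be written uniquely as $D=D_1uD_2d$ with $D_1,D_2$ (possibly empty) Dyck paths. The map $\operatorname{mir}$ is defined recursively by $\operatorname{mir}(\epsilon)=\epsilon$ and $\operatorname{mir}(D_1uD_2d)=\operatorname{mir}(D_2)\,u\,\operatorname{mir}(D_1)\,d$. -}

module Defs where

open import Data.Nat using (ℕ; zero; suc; _+_)
open import Data.Integer as ℤ using (ℤ; +_)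
open import Data.List using (List; []; _∷_; _++_; [_])
open import Relation.Nullary using (yes; no)

data Step : Set where
  u d : Step

-- Dyck paths, represented by their unique first-return-at-end decomposition:
-- ε is the empty path, and  D₁ ⟨u D₂ d⟩  is the path  D₁ u D₂ d.
data Dyck : Set where
  ε    : Dyck
  _⟨u_d⟩ : Dyck → Dyck → Dyck

word : Dyck → List Step
word ε = []
word (D₁ ⟨u D₂ d⟩) = word D₁ ++ (u ∷ word D₂ ++ d ∷ [])

mir : Dyck → Dyck
mir ε = ε
mir (D₁ ⟨u D₂ d⟩) = mir D₂ ⟨u mir D₁ d⟩

δ : Step → ℤ
δ u = + 1
δ d = ℤ.-[1+ 0 ]

contactsFrom : ℤ → List Step → ℕ
contactsFrom h [] = 0
contactsFrom h (s ∷ w) with h ℤ.+ δ s ℤ.≟ + 0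
... | yes _ = suc (contactsFrom (h ℤ.+ δ s) w)
... | no  _ = contactsFrom (h ℤ.+ δ s) w

nonInitialContacts : Dyck → ℕ
nonInitialContacts P = contactsFrom (+ 0) (word P)

replicate : ℕ → Step → List Step
replicate zero s = []
replicate (suc k) s = s ∷ replicate k s

-- A Dyck path D₁ u D₂ d touches the axis once more than D₁ does, since D₂ is
-- travelled strictly above the axis; so the non-initial contacts of P are the
-- returns along the left spine D ↦ D₁ of the decomposition. The map mir sends
-- this spine to the right spine of mir P, each of whose nodes ends the word
-- with one more d.
module Submission where

open import Defs
open import Data.Nat using (ℕ; zero; suc; _+_)
open import Data.Nat.Properties using (+-suc; +-comm; +-identityʳ)
open import Data.Integer as ℤ using (+_)
open import Data.List using (List; []; _∷_; _++_; [_])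
open import Data.List.Properties using (++-assoc; ++-identityʳ)
open import Data.Product using (∃; _,_)
open import Data.Empty using (⊥-elim)
open import Relation.Nullary using (yes; no; ¬_)
open import Relation.Binary.PropositionalEquality using (_≡_; refl; sym; trans; cong; subst; module ≡-Reasoning)

returns : Dyck → ℕ
returns ε = 0
returns (D₁ ⟨u D₂ d⟩) = suc (returns D₁)

contactsFrom-step-≢0 : ∀ h s w → ¬ (h ℤ.+ δ s ≡ + 0) →
                       contactsFrom h (s ∷ w) ≡ contactsFrom (h ℤ.+ δ s) w
contactsFrom-step-≢0 h s w h+δs≢0 with h ℤ.+ δ s ℤ.≟ + 0
... | yes h+δs≡0 = ⊥-elim (h+δs≢0 h+δs≡0)
... | no  _      = refl

contactsFrom-step-≡0 : ∀ h s w → h ℤ.+ δ s ≡ + 0 →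
                       contactsFrom h (s ∷ w) ≡ suc (contactsFrom (+ 0) w)
contactsFrom-step-≡0 h s w h+δs≡0 with h ℤ.+ δ s ℤ.≟ + 0
... | yes _      = cong (λ h′ → suc (contactsFrom h′ w)) h+δs≡0
... | no h+δs≢0  = ⊥-elim (h+δs≢0 h+δs≡0)

word-⟨u⟩-++ : ∀ D₁ D₂ w → word (D₁ ⟨u D₂ d⟩) ++ w ≡ word D₁ ++ (u ∷ word D₂ ++ (d ∷ w))
word-⟨u⟩-++ D₁ D₂ w = begin
  (word D₁ ++ (u ∷ word D₂ ++ [ d ])) ++ w  ≡⟨ ++-assoc (word D₁) _ w ⟩
  word D₁ ++ (u ∷ (word D₂ ++ [ d ]) ++ w)  ≡⟨ cong (λ z → word D₁ ++ (u ∷ z)) (++-assoc (word D₂) [ d ] w) ⟩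
  word D₁ ++ (u ∷ word D₂ ++ (d ∷ w))      ∎
  where open ≡-Reasoning

contactsFrom-suc-word-++ : ∀ m D w →
  contactsFrom (+ suc m) (word D ++ w) ≡ contactsFrom (+ suc m) w
contactsFrom-suc-word-++ m ε w = refl
contactsFrom-suc-word-++ m (D₁ ⟨u D₂ d⟩) w = begin
  contactsFrom (+ suc m) (word (D₁ ⟨u D₂ d⟩) ++ w)
    ≡⟨ cong (contactsFrom (+ suc m)) (word-⟨u⟩-++ D₁ D₂ w) ⟩
  contactsFrom (+ suc m) (word D₁ ++ (u ∷ word D₂ ++ (d ∷ w)))
    ≡⟨ contactsFrom-suc-word-++ m D₁ _ ⟩
  contactsFrom (+ suc m) (u ∷ word D₂ ++ (d ∷ w))
    ≡⟨ contactsFrom-step-≢0 (+ suc m) u (word D₂ ++ (d ∷ w)) (λ ()) ⟩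
  contactsFrom (+ suc m ℤ.+ + 1) (word D₂ ++ (d ∷ w))
    ≡⟨ cong (λ n → contactsFrom (+ suc n) (word D₂ ++ (d ∷ w))) (+-comm m 1) ⟩
  contactsFrom (+ suc (suc m)) (word D₂ ++ (d ∷ w))
    ≡⟨ contactsFrom-suc-word-++ (suc m) D₂ (d ∷ w) ⟩
  contactsFrom (+ suc (suc m)) (d ∷ w)
    ≡⟨ contactsFrom-step-≢0 (+ suc (suc m)) d w (λ ()) ⟩
  contactsFrom (+ suc m) w
    ∎
  where open ≡-Reasoning

contactsFrom-0-word-++ : ∀ D w →
  contactsFrom (+ 0) (word D ++ w) ≡ returns D + contactsFrom (+ 0) w
contactsFrom-0-word-++ ε w = refl
contactsFrom-0-word-++ (D₁ ⟨u D₂ d⟩) w = begin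
  contactsFrom (+ 0) (word (D₁ ⟨u D₂ d⟩) ++ w)
    ≡⟨ cong (contactsFrom (+ 0)) (word-⟨u⟩-++ D₁ D₂ w) ⟩
  contactsFrom (+ 0) (word D₁ ++ (u ∷ word D₂ ++ (d ∷ w)))
    ≡⟨ contactsFrom-0-word-++ D₁ _ ⟩
  returns D₁ + contactsFrom (+ 0) (u ∷ word D₂ ++ (d ∷ w))
    ≡⟨ cong (λ n → returns D₁ + n) (contactsFrom-step-≢0 (+ 0) u (word D₂ ++ (d ∷ w)) (λ ())) ⟩
  returns D₁ + contactsFrom (+ 1) (word D₂ ++ (d ∷ w))
    ≡⟨ cong (λ n → returns D₁ + n) (contactsFrom-suc-word-++ 0 D₂ (d ∷ w)) ⟩
  returns D₁ + contactsFrom (+ 1) (d ∷ w)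
    ≡⟨ cong (λ n → returns D₁ + n) (contactsFrom-step-≡0 (+ 1) d w refl) ⟩
  returns D₁ + suc (contactsFrom (+ 0) w)
    ≡⟨ +-suc (returns D₁) _ ⟩
  suc (returns D₁) + contactsFrom (+ 0) w
    ∎
  where open ≡-Reasoning

nonInitialContacts≡returns : ∀ P → nonInitialContacts P ≡ returns P
nonInitialContacts≡returns P = begin
  contactsFrom (+ 0) (word P)       ≡⟨ cong (contactsFrom (+ 0)) (sym (++-identityʳ (word P))) ⟩
  contactsFrom (+ 0) (word P ++ []) ≡⟨ contactsFrom-0-word-++ P [] ⟩
  returns P + 0                     ≡⟨ +-identityʳ (returns P) ⟩
  returns P                         ∎
  where open ≡-Reasoning

replicate-snoc : ∀ n s → replicate n s ++ [ s ] ≡ replicate (suc n) s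
replicate-snoc zero    s = refl
replicate-snoc (suc n) s = cong (s ∷_) (replicate-snoc n s)

word-mir-endsWith-returns : ∀ P → ∃ λ (w : List Step) → word (mir P) ≡ w ++ replicate (returns P) d
word-mir-endsWith-returns ε = [] , refl
word-mir-endsWith-returns (D₁ ⟨u D₂ d⟩) with word-mir-endsWith-returns D₁
... | v , mirD₁≡v++dⁿ = word (mir D₂) ++ u ∷ v , (begin
    word (mir D₂) ++ (u ∷ word (mir D₁) ++ [ d ])
      ≡⟨ cong (λ z → word (mir D₂) ++ (u ∷ z ++ [ d ])) mirD₁≡v++dⁿ ⟩
    word (mir D₂) ++ (u ∷ (v ++ dⁿ) ++ [ d ])
      ≡⟨ cong (λ z → word (mir D₂) ++ (u ∷ z)) (++-assoc v dⁿ [ d ]) ⟩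
    word (mir D₂) ++ (u ∷ v ++ (dⁿ ++ [ d ]))
      ≡⟨ cong (λ z → word (mir D₂) ++ (u ∷ v ++ z)) (replicate-snoc (returns D₁) d) ⟩
    word (mir D₂) ++ (u ∷ v ++ replicate (suc (returns D₁)) d)
      ≡⟨ sym (++-assoc (word (mir D₂)) (u ∷ v) _) ⟩
    (word (mir D₂) ++ u ∷ v) ++ replicate (suc (returns D₁)) d ∎)
  where
  open ≡-Reasoning
  dⁿ : List Step
  dⁿ = replicate (returns D₁) d

corollary4p8 : (P : Dyck) (k : ℕ) → nonInitialContacts P ≡ k →
               ∃ λ (w : List Step) → word (mir P) ≡ w ++ replicate k d
corollary4p8 P k contacts≡k =
  subst (λ n → ∃ λ (w : List Step) → word (mir P) ≡ w ++ replicate n d)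
        (trans (sym (nonInitialContacts≡returns P)) contacts≡k)
        (word-mir-endsWith-returns P)
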